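{- Let $k\ge 1$ be an integer. The map $\phi_k$ from the Riordan group to the $k$-Riordan group defined by \[ \phi_k(g,f)=\Big(g(z^k),\ \underbrace{z,z,\dots,z}_{k-1},\ \tfrac{f(z^k)}{z^{k-1}}\Big) \] is a group monomorphism. Moreover, for each position $j\in\{1,\dots,k\}$, the map sending $(g,f)$ to the $k$-Riordan array with initial function $g(z^k)$, $j$th multiplier function $f(z^k)/z^{k-1}$, and all other $k-1$ multiplier functions equal to $z$, is also a group monomorphism (so any rearrangement of the multiplier functions gives a monomorphism).
   Context: Work with formal power series in $z$ over $\mathbb{C}$. Let $\mathcal{F}_0$ be the set of formal power series with nonzero constant term, and $\mathcal{F}_1$ the set of formal power series with zero constant term and nonzero coefficient of $z$. The Riordan group consists of the Riordan arrays $(g,f)$ with $g\in\mathcal{F}_0$, $f\in\mathcal{F}_1$ (the lower-triangular matrix whose $n$th column has generating function $gf^n$), with product $(g,f)*(G,F)=(g\,G(f),F(f))$. For $k\ge1$, a $k$-Riordan array $(g,f_1,\dots,f_k)$ consists of $g(z)=\tilde g(z^k)$ with $\tilde g\in\mathcal{F}_0$ and $f_i(z)=\hat f_i(z^k)/z^{k-1}$ with $\hat f_i\in\mathcal{F}_1$; it is the infinite lower-triangular matrix whose column $0$ has generating function $g$ and whose column $n\ge1$ has generating function $g\prod_{m=1}^{n} f_{((m-1)\bmod k)+1}$ (the multiplier functions $f_1,\dots,f_k$ are applied cyclically). The $k$-Riordan group is the set of these arrays under matrix multiplication, given by $(g,f_1,\dots,f_k)*(G,F_1,\dots,F_k)=\big(g\,G(h),\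 \tfrac{f_1}{h}F_1(h),\dots,\tfrac{f_k}{h}F_k(h)\big)$ where $h\in\mathcal{F}_1$ satisfies $h^k=f_1f_2\cdots f_k$ (the result is independent of the choice of $k$th root). For $k=2$ this is the Double Riordan group. -}

module Defs where

open import Level using (Level; _⊔_) renaming (suc to lsuc)
open import Algebra.Bundles using (CommutativeRing)
open import Data.Nat using (ℕ; zero; suc; _∸_; _%_; _/_)
open import Data.Nat as N using ()
open import Data.Nat.DivMod using (m%n<n)
open import Data.Fin using (Fin; fromℕ<; fromℕ; _≟_)
open import Data.Product using (Σ; _×_)
open import Data.Bool using (if_then_else_)
open import Relation.Nullary using (¬_)
open import Relation.Nullary.Decidable using (⌊_⌋)

-- A field: a commutative ring with 1 ≠ 0 in which every nonzero element is invertible.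
-- (The paper works over ℂ; the statement is proved here for an arbitrary field.)
record Field (c ℓ : Level) : Set (lsuc (c ⊔ ℓ)) where
  field
    ring : CommutativeRing c ℓ
  open CommutativeRing ring
  field
    1≉0     : ¬ (1# ≈ 0#)
    inverse : ∀ x → ¬ (x ≈ 0#) → Σ Carrier (λ y → x * y ≈ 1#)

module FPS {c ℓ : Level} (R : CommutativeRing c ℓ) where
  open CommutativeRing R using (Carrier; _≈_; _+_; _*_; 0#; 1#)

  Series : Set c
  Series = ℕ → Carrier

  _≋_ : Series → Series → Set ℓ
  a ≋ b = ∀ n → a n ≈ b n

  sumUpTo : (ℕ → Carrier) → ℕ → Carrier
  sumUpTo h zero    = h zero
  sumUpTo h (suc n) = sumUpTo h n + h (suc n)

  _⊛_ : Series → Series → Series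
  (a ⊛ b) n = sumUpTo (λ i → a i * b (n ∸ i)) n

  oneS : Series
  oneS zero    = 1#
  oneS (suc _) = 0#

  zS : Series
  zS zero          = 0#
  zS (suc zero)    = 1#
  zS (suc (suc _)) = 0#

  powS : Series → ℕ → Series
  powS a zero    = oneS
  powS a (suc m) = a ⊛ powS a m

  -- composition G(f), for f with zero constant term (then f^m has order ≥ m)
  compose : Series → Series → Series
  compose G f n = sumUpTo (λ m → G m * powS f m n) n

  InF0 : Series → Set ℓ
  InF0 g = ¬ (g 0 ≈ 0#)

  InF1 : Series → Set ℓ
  InF1 f = (f 0 ≈ 0#) × ¬ (f 1 ≈ 0#)

  riordanMulG : Series → Series → Series → Series → Series
  riordanMulG g f G F = g ⊛ compose G f

  riordanMulF : Series → Series → Series → Series → Series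
  riordanMulF g f G F = compose F f

  -- Throughout, k = suc k'.
  -- stretch k' a = a(z^k)
  stretch : ℕ → Series → Series
  stretch k' a n with n % suc k'
  ... | zero  = a (n / suc k')
  ... | suc _ = 0#

  -- shiftDown j a = a / z^j (for a of order ≥ j)
  shiftDown : ℕ → Series → Series
  shiftDown j a n = a (n N.+ j)

  -- infinite matrices (row, column)
  Matrix : Set c
  Matrix = ℕ → ℕ → Carrier

  _≐_ : Matrix → Matrix → Set ℓ
  A ≐ B = ∀ n j → A n j ≈ B n j

  -- product of infinite lower-triangular matrices: (AB)_{n,j} = Σ_{i ≤ n} A_{n,i} B_{i,j}
  _·ₘ_ : Matrix → Matrix → Matrix
  (A ·ₘ B) n j = sumUpTo (λ i → A n i * B i j) n

  -- index ((m-1) mod k) (0-based) of the multiplier used for column m = suc n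
  cyc : (k' n : ℕ) → Fin (suc k')
  cyc k' n = fromℕ< (m%n<n n (suc k'))

  -- the k-Riordan array (g, f₁, …, f_k) with g = g̃(z^k), fᵢ = f̂ᵢ(z^k)/z^{k-1};
  -- column j has generating function g ∏_{m=1}^{j} f_{((m-1) mod k)+1}
  kColumn : (k' : ℕ) → Series → (Fin (suc k') → Series) → ℕ → Series
  kColumn k' gt fh zero    = stretch k' gt
  kColumn k' gt fh (suc n) = kColumn k' gt fh n ⊛ shiftDown k' (stretch k' (fh (cyc k' n)))

  kMatrix : (k' : ℕ) → Series → (Fin (suc k') → Series) → Matrix
  kMatrix k' gt fh n j = kColumn k' gt fh j n

  -- the hatted multipliers: f at position j (0-based), z elsewhere
  -- (z = z^k / z^{k-1}, i.e. hatted function z)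
  multsAt : (k' : ℕ) → Fin (suc k') → Series → Fin (suc k') → Series
  multsAt k' j f i = if ⌊ i ≟ j ⌋ then f else zS

  phiAt : (k' : ℕ) → Fin (suc k') → Series → Series → Matrix
  phiAt k' j g f = kMatrix k' g (multsAt k' j f)

  -- phiAt k' j is a group monomorphism from the Riordan group into the k-Riordan group
  -- (the group operation on the k-Riordan group being matrix multiplication):
  -- it is multiplicative and injective.
  IsMonoAt : (k' : ℕ) → Fin (suc k') → Set (c ⊔ ℓ)
  IsMonoAt k' j =
    (∀ g f G F → InF0 g → InF1 f → InF0 G → InF1 F →
       phiAt k' j (riordanMulG g f G F) (riordanMulF g f G F)
         ≐ (phiAt k' j g f ·ₘ phiAt k' j G F))
    × (∀ g f G F → InF0 g → InF1 f → InF0 G → InF1 F →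
       phiAt k' j g f ≐ phiAt k' j G F → (g ≋ G) × (f ≋ F))

-- Let e(n) and m(n) count how many of the first n cyclically applied multipliers of φ_j(g,f)
-- are f(z^k)/z^(k-1) and z respectively. Column n is then (z^m(n) g f^e(n))(z^k) / z^(n(k-1)),
-- so an entry vanishes unless its row and column are congruent mod k, and since every period of
-- k multipliers contains f exactly once, the entry in row Qk+r and column tk+r is
-- [z^(e+Q)] g f^(e+t) with e = e(r). On each residue class φ_j(g,f) is therefore the Riordan
-- array (g,f) with its first e rows and columns deleted; the deleted rows of a Riordan array
-- vanish in the remaining columns, so multiplicativity reduces to the Riordan product rule
-- [z^Q] g G(f) F(f)^q = Σ_t [z^Q] g f^t · [z^t] G F^q. The residue class 0 recovers the
-- columns g and g f, and g(0) is invertible, which gives injectivity.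

module Submission where

open import Level using (Level)
open import Algebra.Bundles using (CommutativeRing)
import Algebra.Properties.CommutativeSemigroup as CommutativeSemigroupProperties
import Algebra.Properties.Group as GroupProperties
open import Data.Empty using (⊥-elim)
open import Data.Fin using (Fin; toℕ; fromℕ; _≟_)
import Data.Fin.Properties as Finₚ
open import Data.Nat as ℕ using (ℕ; zero; suc; _∸_; _%_; _/_; _≤_; _<_; z≤n; s≤s)
import Data.Nat.Properties as ℕₚ
open import Data.Nat.DivMod using (m≡m%n+[m/n]*n; m%n<n; m<n⇒m%n≡m; [m+kn]%n≡m%n; [m+n]%n≡m%n; %-distribˡ-+; m%n%n≡m%n; m*n/n≡m; m*n%n≡0; m<n*o⇒m/o<n)
open import Data.Nat.Tactic.RingSolver using (solve-∀)
open import Data.Product using (_×_; _,_; proj₁; proj₂)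
open import Data.Sum using (inj₁; inj₂)
open import Function using (_∘_)
open import Relation.Binary.PropositionalEquality as ≡ using (_≡_; _≢_)
open import Relation.Nullary using (¬_; yes; no)
import Relation.Binary.Reasoning.Setoid as SetoidReasoning

open import Defs

module ResidueArithmetic (k′ : ℕ) where

  k : ℕ
  k = suc k′

  [qk+r]%k≡r : ∀ q r → r < k → (q ℕ.* k ℕ.+ r) % k ≡ r
  [qk+r]%k≡r q r r<k = ≡.trans (≡.cong (_% k) (ℕₚ.+-comm (q ℕ.* k) r))
                               (≡.trans ([m+kn]%n≡m%n r q k) (m<n⇒m%n≡m r<k))

  n≡[n/k]k+n%k : ∀ n → n ≡ n / k ℕ.* k ℕ.+ n % k
  n≡[n/k]k+n%k n = ≡.trans (m≡m%n+[m/n]*n n k) (ℕₚ.+-comm (n % k) _)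

  [N+nk′]%k≡0⇒N%k≡n%k : ∀ N n → (N ℕ.+ n ℕ.* k′) % k ≡ 0 → N % k ≡ n % k
  [N+nk′]%k≡0⇒N%k≡n%k N n eq = begin
    N % k                                    ≡⟨ [m+kn]%n≡m%n N n k ⟨
    (N ℕ.+ n ℕ.* k) % k                      ≡⟨ ≡.cong (_% k) (regroup N n k′) ⟩
    (N ℕ.+ n ℕ.* k′ ℕ.+ n) % k               ≡⟨ %-distribˡ-+ (N ℕ.+ n ℕ.* k′) n k ⟩
    ((N ℕ.+ n ℕ.* k′) % k ℕ.+ n % k) % k     ≡⟨ ≡.cong (λ x → (x ℕ.+ n % k) % k) eq ⟩
    n % k % k                                ≡⟨ m%n%n≡m%n n k ⟩
    n % k                                    ∎
    where
    open ≡.≡-Reasoning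
    regroup : ∀ N n k′ → N ℕ.+ n ℕ.* suc k′ ≡ N ℕ.+ n ℕ.* k′ ℕ.+ n
    regroup = solve-∀

module SeriesProperties {c ℓ : Level} (R : CommutativeRing c ℓ) where

  open CommutativeRing R
  open FPS R
  open SetoidReasoning setoid

  reindex : ∀ (h : ℕ → Carrier) {i i′} → i ≡ i′ → h i ≈ h i′
  reindex h ≡.refl = refl

  sumUpTo-cong : ∀ n {h h′ : ℕ → Carrier} → (∀ i → i ≤ n → h i ≈ h′ i) → sumUpTo h n ≈ sumUpTo h′ n
  sumUpTo-cong zero    h≈h′ = h≈h′ 0 z≤n
  sumUpTo-cong (suc n) h≈h′ = +-cong (sumUpTo-cong n (λ i i≤n → h≈h′ i (ℕₚ.m≤n⇒m≤1+n i≤n))) (h≈h′ (suc n) ℕₚ.≤-refl)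

  sumUpTo-cong′ : ∀ n {h h′ : ℕ → Carrier} → (∀ i → h i ≈ h′ i) → sumUpTo h n ≈ sumUpTo h′ n
  sumUpTo-cong′ n h≈h′ = sumUpTo-cong n (λ i _ → h≈h′ i)

  sumUpTo-zero : ∀ n {h : ℕ → Carrier} → (∀ i → i ≤ n → h i ≈ 0#) → sumUpTo h n ≈ 0#
  sumUpTo-zero n h≈0 = trans (sumUpTo-cong n h≈0) (sumUpTo-0# n)
    where
    sumUpTo-0# : ∀ n → sumUpTo (λ _ → 0#) n ≈ 0#
    sumUpTo-0# zero    = refl
    sumUpTo-0# (suc n) = trans (+-identityʳ _) (sumUpTo-0# n)

  sumUpTo-+ : ∀ n (h h′ : ℕ → Carrier) → sumUpTo (λ i → h i + h′ i) n ≈ sumUpTo h n + sumUpTo h′ n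
  sumUpTo-+ zero    h h′ = refl
  sumUpTo-+ (suc n) h h′ = trans (+-cong (sumUpTo-+ n h h′) refl) (interchange _ _ _ _)
    where open CommutativeSemigroupProperties +-commutativeSemigroup using (interchange)

  *-distribˡ-sumUpTo : ∀ n x (h : ℕ → Carrier) → x * sumUpTo h n ≈ sumUpTo (λ i → x * h i) n
  *-distribˡ-sumUpTo zero    x h = refl
  *-distribˡ-sumUpTo (suc n) x h = trans (distribˡ x _ _) (+-cong (*-distribˡ-sumUpTo n x h) refl)

  *-distribʳ-sumUpTo : ∀ n x (h : ℕ → Carrier) → sumUpTo h n * x ≈ sumUpTo (λ i → h i * x) n
  *-distribʳ-sumUpTo zero    x h = refl
  *-distribʳ-sumUpTo (suc n) x h = trans (distribʳ x _ _) (+-cong (*-distribʳ-sumUpTo n x h) refl)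

  sumUpTo-swap : ∀ n m (h : ℕ → ℕ → Carrier) →
    sumUpTo (λ i → sumUpTo (h i) m) n ≈ sumUpTo (λ l → sumUpTo (λ i → h i l) n) m
  sumUpTo-swap zero    m h = refl
  sumUpTo-swap (suc n) m h = trans (+-cong (sumUpTo-swap n m h) refl) (sym (sumUpTo-+ m _ _))

  sumUpTo-head : ∀ n (h : ℕ → Carrier) → sumUpTo h (suc n) ≈ h 0 + sumUpTo (h ∘ suc) n
  sumUpTo-head zero    h = refl
  sumUpTo-head (suc n) h = trans (+-cong (sumUpTo-head n h) refl) (+-assoc _ _ _)

  sumUpTo-split : ∀ m n (h : ℕ → Carrier) →
    sumUpTo h (suc m ℕ.+ n) ≈ sumUpTo h m + sumUpTo (λ i → h (suc m ℕ.+ i)) n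
  sumUpTo-split zero    n h = sumUpTo-head n h
  sumUpTo-split (suc m) n h = begin
    sumUpTo h (suc (suc m ℕ.+ n))                                          ≈⟨ sumUpTo-head (suc m ℕ.+ n) h ⟩
    h 0 + sumUpTo (h ∘ suc) (suc m ℕ.+ n)                                  ≈⟨ +-cong refl (sumUpTo-split m n (h ∘ suc)) ⟩
    h 0 + (sumUpTo (h ∘ suc) m + sumUpTo (λ i → h (suc (suc m ℕ.+ i))) n)  ≈⟨ sym (+-assoc _ _ _) ⟩
    (h 0 + sumUpTo (h ∘ suc) m) + sumUpTo (λ i → h (suc (suc m ℕ.+ i))) n  ≈⟨ +-cong (sym (sumUpTo-head m h)) refl ⟩
    sumUpTo h (suc m) + sumUpTo (λ i → h (suc (suc m ℕ.+ i))) n            ∎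

  sumUpTo-dropZeros : ∀ s n (h : ℕ → Carrier) → (∀ i → i < s → h i ≈ 0#) →
    sumUpTo h (s ℕ.+ n) ≈ sumUpTo (λ i → h (s ℕ.+ i)) n
  sumUpTo-dropZeros zero    n h h≈0 = refl
  sumUpTo-dropZeros (suc s) n h h≈0 =
    trans (sumUpTo-split s n h)
          (trans (+-cong (sumUpTo-zero s (λ i i≤s → h≈0 i (s≤s i≤s))) refl) (+-identityˡ _))

  sumUpTo-extend : ∀ {n m} → n ≤ m → (h : ℕ → Carrier) → (∀ i → n < i → i ≤ m → h i ≈ 0#) →
    sumUpTo h n ≈ sumUpTo h m
  sumUpTo-extend n≤m = extend′ (ℕₚ.≤⇒≤′ n≤m)
    where
    extend′ : ∀ {n m} → n ℕ.≤′ m → (h : ℕ → Carrier) → (∀ i → n < i → i ≤ m → h i ≈ 0#) →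
      sumUpTo h n ≈ sumUpTo h m
    extend′ ℕ.≤′-refl            h h≈0 = refl
    extend′ (ℕ.≤′-step {m} n≤′m) h h≈0 =
      trans (extend′ n≤′m h (λ i n<i i≤m → h≈0 i n<i (ℕₚ.m≤n⇒m≤1+n i≤m)))
            (trans (sym (+-identityʳ _)) (+-cong refl (sym (h≈0 (suc m) (s≤s (ℕₚ.≤′⇒≤ n≤′m)) ℕₚ.≤-refl))))

  sumUpTo-single : ∀ {r} m (h : ℕ → Carrier) → r ≤ m → (∀ i → i ≤ m → i ≢ r → h i ≈ 0#) →
    sumUpTo h m ≈ h r
  sumUpTo-single zero h z≤n h≈0 = refl
  sumUpTo-single {r} (suc m) h r≤1+m h≈0 with ℕₚ.m≤n⇒m<n∨m≡n r≤1+m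
  ... | inj₁ r<1+m = trans (+-cong (sumUpTo-single m h (ℕₚ.≤-pred r<1+m) (λ i i≤m → h≈0 i (ℕₚ.m≤n⇒m≤1+n i≤m)))
                                   (h≈0 (suc m) ℕₚ.≤-refl (ℕₚ.>⇒≢ r<1+m)))
                           (+-identityʳ _)
  ... | inj₂ ≡.refl = trans (+-cong (sumUpTo-zero m (λ i i≤m → h≈0 i (ℕₚ.m≤n⇒m≤1+n i≤m) (ℕₚ.<⇒≢ (s≤s i≤m)))) refl)
                            (+-identityˡ _)

  sumUpTo-reverse : ∀ n (h : ℕ → Carrier) → sumUpTo h n ≈ sumUpTo (λ i → h (n ∸ i)) n
  sumUpTo-reverse zero    h = refl
  sumUpTo-reverse (suc n) h = begin
    sumUpTo h n + h (suc n)                      ≈⟨ +-cong (sumUpTo-reverse n h) refl ⟩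
    sumUpTo (λ i → h (n ∸ i)) n + h (suc n)      ≈⟨ +-comm _ _ ⟩
    h (suc n) + sumUpTo (λ i → h (n ∸ i)) n      ≈⟨ sym (sumUpTo-head n (λ i → h (suc n ∸ i))) ⟩
    sumUpTo (λ i → h (suc n ∸ i)) (suc n)        ∎

  sumUpTo-triangle : ∀ n (h : ℕ → ℕ → Carrier) →
    sumUpTo (λ m → sumUpTo (λ i → h i (m ∸ i)) m) n ≈ sumUpTo (λ i → sumUpTo (h i) (n ∸ i)) n
  sumUpTo-triangle zero    h = refl
  sumUpTo-triangle (suc n) h = begin
    sumUpTo (λ m → sumUpTo (λ i → h i (m ∸ i)) m) n + sumUpTo (λ i → h i (suc n ∸ i)) (suc n)
      ≈⟨ +-cong (sumUpTo-triangle n h) refl ⟩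
    sumUpTo (λ i → sumUpTo (h i) (n ∸ i)) n + (sumUpTo (λ i → h i (suc n ∸ i)) n + h (suc n) (n ∸ n))
      ≈⟨ sym (+-assoc _ _ _) ⟩
    (sumUpTo (λ i → sumUpTo (h i) (n ∸ i)) n + sumUpTo (λ i → h i (suc n ∸ i)) n) + h (suc n) (n ∸ n)
      ≈⟨ +-cong (sym (sumUpTo-+ n _ _)) refl ⟩
    sumUpTo (λ i → sumUpTo (h i) (n ∸ i) + h i (suc n ∸ i)) n + h (suc n) (n ∸ n)
      ≈⟨ +-cong (sumUpTo-cong n (λ i i≤n → +-cong refl (reindex (h i) (ℕₚ.+-∸-assoc 1 i≤n)))) refl ⟩
    sumUpTo (λ i → sumUpTo (h i) (suc (n ∸ i))) n + h (suc n) (n ∸ n)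
      ≈⟨ +-cong (sumUpTo-cong n (λ i i≤n → reindex (sumUpTo (h i)) (≡.sym (ℕₚ.+-∸-assoc 1 i≤n)))) lastTerm ⟩
    sumUpTo (λ i → sumUpTo (h i) (suc n ∸ i)) (suc n)
      ∎
    where
    lastTerm : h (suc n) (n ∸ n) ≈ sumUpTo (h (suc n)) (n ∸ n)
    lastTerm rewrite ℕₚ.n∸n≡0 n = refl

  ≋-refl : ∀ {a} → a ≋ a
  ≋-refl n = refl

  ≋-sym : ∀ {a b} → a ≋ b → b ≋ a
  ≋-sym a≋b n = sym (a≋b n)

  ≋-trans : ∀ {a b d} → a ≋ b → b ≋ d → a ≋ d
  ≋-trans a≋b b≋d n = trans (a≋b n) (b≋d n)

  ⊛-cong : ∀ {a a′ b b′} → a ≋ a′ → b ≋ b′ → (a ⊛ b) ≋ (a′ ⊛ b′)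
  ⊛-cong a≋a′ b≋b′ n = sumUpTo-cong′ n (λ i → *-cong (a≋a′ i) (b≋b′ (n ∸ i)))

  ⊛-comm : ∀ a b → (a ⊛ b) ≋ (b ⊛ a)
  ⊛-comm a b n = trans (sumUpTo-reverse n (λ i → a i * b (n ∸ i)))
    (sumUpTo-cong n (λ i i≤n → trans (*-comm _ _) (*-cong (reindex b (ℕₚ.m∸[m∸n]≡n i≤n)) refl)))

  ⊛-assoc : ∀ a b d → ((a ⊛ b) ⊛ d) ≋ (a ⊛ (b ⊛ d))
  ⊛-assoc a b d n = begin
    sumUpTo (λ m → sumUpTo (λ i → a i * b (m ∸ i)) m * d (n ∸ m)) n
      ≈⟨ sumUpTo-cong′ n (λ m → *-distribʳ-sumUpTo m _ _) ⟩
    sumUpTo (λ m → sumUpTo (λ i → a i * b (m ∸ i) * d (n ∸ m)) m) n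
      ≈⟨ sumUpTo-cong′ n (λ m → sumUpTo-cong m (λ i i≤m → *-cong refl (reindex (λ x → d (n ∸ x)) (i+[m∸i]≡m i≤m)))) ⟩
    sumUpTo (λ m → sumUpTo (λ i → H i (m ∸ i)) m) n
      ≈⟨ sumUpTo-triangle n H ⟩
    sumUpTo (λ i → sumUpTo (H i) (n ∸ i)) n
      ≈⟨ sumUpTo-cong′ n (λ i → trans (sumUpTo-cong′ (n ∸ i) (H-factor i)) (sym (*-distribˡ-sumUpTo (n ∸ i) _ _))) ⟩
    sumUpTo (λ i → a i * sumUpTo (λ l → b l * d (n ∸ i ∸ l)) (n ∸ i)) n
      ∎
    where
    H : ℕ → ℕ → Carrier
    H i l = a i * b l * d (n ∸ (i ℕ.+ l))
    i+[m∸i]≡m : ∀ {i m} → i ≤ m → m ≡ i ℕ.+ (m ∸ i)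
    i+[m∸i]≡m i≤m = ≡.sym (ℕₚ.m+[n∸m]≡n i≤m)
    H-factor : ∀ i l → H i l ≈ a i * (b l * d (n ∸ i ∸ l))
    H-factor i l = trans (*-assoc _ _ _) (*-cong refl (*-cong refl (reindex d (≡.sym (ℕₚ.∸-+-assoc n i l)))))

  ⊛-identityˡ : ∀ a → (oneS ⊛ a) ≋ a
  ⊛-identityˡ a n = trans (sumUpTo-single n _ z≤n otherTermsVanish) (*-identityˡ _)
    where
    otherTermsVanish : ∀ i → i ≤ n → i ≢ 0 → oneS i * a (n ∸ i) ≈ 0#
    otherTermsVanish zero    _ 0≢0 = ⊥-elim (0≢0 ≡.refl)
    otherTermsVanish (suc i) _ _   = zeroˡ _

  ⊛-identityʳ : ∀ a → (a ⊛ oneS) ≋ a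
  ⊛-identityʳ a = ≋-trans (⊛-comm a oneS) (⊛-identityˡ a)

  powS-+ : ∀ a p q → powS a (p ℕ.+ q) ≋ (powS a p ⊛ powS a q)
  powS-+ a zero    q = ≋-sym (⊛-identityˡ (powS a q))
  powS-+ a (suc p) q = ≋-trans (⊛-cong ≋-refl (powS-+ a p q)) (≋-sym (⊛-assoc a (powS a p) (powS a q)))

  OrderAtLeast : ℕ → Series → Set ℓ
  OrderAtLeast s a = ∀ i → i < s → a i ≈ 0#

  OrderAtLeast-weaken : ∀ {s s′ a} → s′ ≤ s → OrderAtLeast s a → OrderAtLeast s′ a
  OrderAtLeast-weaken s′≤s ord i i<s′ = ord i (ℕₚ.<-≤-trans i<s′ s′≤s)

  ⊛-orderAtLeast : ∀ {s t a b} → OrderAtLeast s a → OrderAtLeast t b → OrderAtLeast (s ℕ.+ t) (a ⊛ b)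
  ⊛-orderAtLeast {s} {t} {a} {b} ord-a ord-b n n<s+t = sumUpTo-zero n term
    where
    term : ∀ i → i ≤ n → a i * b (n ∸ i) ≈ 0#
    term i i≤n with ℕₚ.<-≤-connex i s
    ... | inj₁ i<s = trans (*-cong (ord-a i i<s) refl) (zeroˡ _)
    ... | inj₂ s≤i = trans (*-cong refl (ord-b (n ∸ i) n∸i<t)) (zeroʳ _)
      where
      n∸i<t : n ∸ i < t
      n∸i<t = ℕₚ.+-cancelˡ-< i (n ∸ i) t
        (ℕₚ.≤-<-trans (ℕₚ.≤-reflexive (ℕₚ.m+[n∸m]≡n i≤n)) (ℕₚ.<-≤-trans n<s+t (ℕₚ.+-monoˡ-≤ t s≤i)))

  powS-orderAtLeast : ∀ {a} → OrderAtLeast 1 a → ∀ m → OrderAtLeast m (powS a m)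
  powS-orderAtLeast ord-a zero    i ()
  powS-orderAtLeast ord-a (suc m) = ⊛-orderAtLeast ord-a (powS-orderAtLeast ord-a m)

  orderAtLeast-1 : ∀ {a} → a 0 ≈ 0# → OrderAtLeast 1 a
  orderAtLeast-1 a0≈0 zero    _ = a0≈0
  orderAtLeast-1 a0≈0 (suc _) (s≤s ())

  zS-orderAtLeast : OrderAtLeast 1 zS
  zS-orderAtLeast = orderAtLeast-1 refl

  zS-⊛ : ∀ a n → (zS ⊛ a) (suc n) ≈ a n
  zS-⊛ a n = trans (sumUpTo-single (suc n) _ (s≤s z≤n) otherTermsVanish) (*-identityˡ _)
    where
    otherTermsVanish : ∀ i → i ≤ suc n → i ≢ 1 → zS i * a (suc n ∸ i) ≈ 0#
    otherTermsVanish zero          _ _   = zeroˡ _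
    otherTermsVanish (suc zero)    _ 1≢1 = ⊥-elim (1≢1 ≡.refl)
    otherTermsVanish (suc (suc i)) _ _   = zeroˡ _

  powS-zS-⊛ : ∀ p a n → (powS zS p ⊛ a) (p ℕ.+ n) ≈ a n
  powS-zS-⊛ zero    a n = ⊛-identityˡ a n
  powS-zS-⊛ (suc p) a n = trans (⊛-assoc zS (powS zS p) a (suc (p ℕ.+ n)))
                                (trans (zS-⊛ (powS zS p ⊛ a) (p ℕ.+ n)) (powS-zS-⊛ p a n))

  shiftDown-⊛ : ∀ {s t a b} → OrderAtLeast s a → OrderAtLeast t b →
    (shiftDown s a ⊛ shiftDown t b) ≋ shiftDown (s ℕ.+ t) (a ⊛ b)
  shiftDown-⊛ {s} {t} {a} {b} ord-a ord-b n = sym (begin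
    (a ⊛ b) (n ℕ.+ (s ℕ.+ t))
      ≡⟨ ≡.cong (a ⊛ b) (reorder n s t) ⟩
    (a ⊛ b) (s ℕ.+ (n ℕ.+ t))
      ≈⟨ sumUpTo-dropZeros s (n ℕ.+ t) _ (λ i i<s → trans (*-cong (ord-a i i<s) refl) (zeroˡ _)) ⟩
    sumUpTo (λ i → a (s ℕ.+ i) * b (s ℕ.+ (n ℕ.+ t) ∸ (s ℕ.+ i))) (n ℕ.+ t)
      ≈⟨ sumUpTo-cong′ (n ℕ.+ t) (λ i → *-cong refl (reindex b (ℕₚ.[m+n]∸[m+o]≡n∸o s (n ℕ.+ t) i))) ⟩
    sumUpTo (λ i → a (s ℕ.+ i) * b (n ℕ.+ t ∸ i)) (n ℕ.+ t)
      ≈⟨ sumUpTo-extend (ℕₚ.m≤m+n n t) _ (λ i n<i i≤n+t → trans (*-cong refl (ord-b _ (n+t∸i<t i n<i i≤n+t))) (zeroʳ _)) ⟨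
    sumUpTo (λ i → a (s ℕ.+ i) * b (n ℕ.+ t ∸ i)) n
      ≈⟨ sumUpTo-cong n (λ i i≤n → *-cong (reindex a (ℕₚ.+-comm s i)) (reindex b (ℕₚ.+-∸-comm t i≤n))) ⟩
    (shiftDown s a ⊛ shiftDown t b) n
      ∎)
    where
    reorder : ∀ n s t → n ℕ.+ (s ℕ.+ t) ≡ s ℕ.+ (n ℕ.+ t)
    reorder = solve-∀
    n+t∸i<t : ∀ i → n < i → i ≤ n ℕ.+ t → n ℕ.+ t ∸ i < t
    n+t∸i<t i n<i i≤n+t = ℕₚ.+-cancelˡ-< i _ t
      (≡.subst (_< i ℕ.+ t) (≡.sym (ℕₚ.m+[n∸m]≡n i≤n+t)) (ℕₚ.+-monoˡ-< t n<i))

  module _ {f : Series} (ord-f : OrderAtLeast 1 f) where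

    compose-cong : ∀ {G G′} → G ≋ G′ → compose G f ≋ compose G′ f
    compose-cong G≋G′ n = sumUpTo-cong′ n (λ m → *-cong (G≋G′ m) refl)

    compose-truncate : ∀ G {n N} → n ≤ N → compose G f n ≈ sumUpTo (λ m → G m * powS f m n) N
    compose-truncate G {n} n≤N = sumUpTo-extend n≤N _
      (λ m n<m _ → trans (*-cong refl (powS-orderAtLeast ord-f m n n<m)) (zeroʳ _))

    ⊛-compose : ∀ g v Q → (g ⊛ compose v f) Q ≈ sumUpTo (λ t → (g ⊛ powS f t) Q * v t) Q
    ⊛-compose g v Q = begin
      sumUpTo (λ i → g i * compose v f (Q ∸ i)) Q
        ≈⟨ sumUpTo-cong′ Q (λ i → *-cong refl (compose-truncate v (ℕₚ.m∸n≤m Q i))) ⟩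
      sumUpTo (λ i → g i * sumUpTo (λ t → v t * powS f t (Q ∸ i)) Q) Q
        ≈⟨ sumUpTo-cong′ Q (λ i → *-distribˡ-sumUpTo Q _ _) ⟩
      sumUpTo (λ i → sumUpTo (λ t → g i * (v t * powS f t (Q ∸ i))) Q) Q
        ≈⟨ sumUpTo-swap Q Q _ ⟩
      sumUpTo (λ t → sumUpTo (λ i → g i * (v t * powS f t (Q ∸ i))) Q) Q
        ≈⟨ sumUpTo-cong′ Q (λ t → sumUpTo-cong′ Q (λ i → x∙yz≈xz∙y _ _ _)) ⟩
      sumUpTo (λ t → sumUpTo (λ i → g i * powS f t (Q ∸ i) * v t) Q) Q
        ≈⟨ sumUpTo-cong′ Q (λ t → sym (*-distribʳ-sumUpTo Q _ _)) ⟩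
      sumUpTo (λ t → (g ⊛ powS f t) Q * v t) Q
        ∎
      where open CommutativeSemigroupProperties *-commutativeSemigroup using (x∙yz≈xz∙y)

    compose-⊛ : ∀ a b → compose (a ⊛ b) f ≋ (compose a f ⊛ compose b f)
    compose-⊛ a b n = trans expandˡ (sym expandʳ)
      where
      open CommutativeSemigroupProperties *-commutativeSemigroup using (xy∙z≈zy∙x)
      H : ℕ → ℕ → Carrier
      H l i = b l * a i * powS f (l ℕ.+ i) n
      l+[m∸l]≡m : ∀ {l m} → l ≤ m → m ≡ l ℕ.+ (m ∸ l)
      l+[m∸l]≡m l≤m = ≡.sym (ℕₚ.m+[n∸m]≡n l≤m)
      H-vanishes : ∀ l i → l ≤ n → n ∸ l < i → H l i ≈ 0#
      H-vanishes l i l≤n n∸l<i = trans (*-cong refl (powS-orderAtLeast ord-f (l ℕ.+ i) n n<l+i)) (zeroʳ _)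
        where
        n<l+i : n < l ℕ.+ i
        n<l+i = ≡.subst (_< l ℕ.+ i) (ℕₚ.m+[n∸m]≡n l≤n) (ℕₚ.+-monoʳ-< l n∸l<i)
      expandˡ : compose (a ⊛ b) f n ≈ sumUpTo (λ l → sumUpTo (H l) n) n
      expandˡ = begin
        compose (a ⊛ b) f n
          ≈⟨ compose-cong (⊛-comm a b) n ⟩
        sumUpTo (λ m → sumUpTo (λ l → b l * a (m ∸ l)) m * powS f m n) n
          ≈⟨ sumUpTo-cong′ n (λ m → *-distribʳ-sumUpTo m _ _) ⟩
        sumUpTo (λ m → sumUpTo (λ l → b l * a (m ∸ l) * powS f m n) m) n
          ≈⟨ sumUpTo-cong′ n (λ m → sumUpTo-cong m (λ l l≤m → *-cong refl (reindex (λ x → powS f x n) (l+[m∸l]≡m l≤m)))) ⟩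
        sumUpTo (λ m → sumUpTo (λ l → H l (m ∸ l)) m) n
          ≈⟨ sumUpTo-triangle n H ⟩
        sumUpTo (λ l → sumUpTo (H l) (n ∸ l)) n
          ≈⟨ sumUpTo-cong n (λ l l≤n → sumUpTo-extend (ℕₚ.m∸n≤m n l) (H l) (λ i n∸l<i _ → H-vanishes l i l≤n n∸l<i)) ⟩
        sumUpTo (λ l → sumUpTo (H l) n) n
          ∎
      expandʳ : (compose a f ⊛ compose b f) n ≈ sumUpTo (λ l → sumUpTo (H l) n) n
      expandʳ = begin
        (compose a f ⊛ compose b f) n
          ≈⟨ ⊛-compose (compose a f) b n ⟩
        sumUpTo (λ l → (compose a f ⊛ powS f l) n * b l) n
          ≈⟨ sumUpTo-cong′ n (λ l → *-cong (trans (⊛-comm _ _ n) (⊛-compose (powS f l) a n)) refl) ⟩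
        sumUpTo (λ l → sumUpTo (λ i → (powS f l ⊛ powS f i) n * a i) n * b l) n
          ≈⟨ sumUpTo-cong′ n (λ l → *-distribʳ-sumUpTo n _ _) ⟩
        sumUpTo (λ l → sumUpTo (λ i → (powS f l ⊛ powS f i) n * a i * b l) n) n
          ≈⟨ sumUpTo-cong′ n (λ l → sumUpTo-cong′ n (λ i → trans (xy∙z≈zy∙x _ _ _) (*-cong refl (sym (powS-+ f l i n))))) ⟩
        sumUpTo (λ l → sumUpTo (H l) n) n
          ∎

    compose-oneS : compose oneS f ≋ oneS
    compose-oneS n = trans (sumUpTo-single n _ z≤n otherTermsVanish) (*-identityˡ _)
      where
      otherTermsVanish : ∀ m → m ≤ n → m ≢ 0 → oneS m * powS f m n ≈ 0#
      otherTermsVanish zero    _ 0≢0 = ⊥-elim (0≢0 ≡.refl)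
      otherTermsVanish (suc m) _ _   = zeroˡ _

    compose-powS : ∀ F q → compose (powS F q) f ≋ powS (compose F f) q
    compose-powS F zero    = compose-oneS
    compose-powS F (suc q) = ≋-trans (compose-⊛ F (powS F q)) (⊛-cong ≋-refl (compose-powS F q))

    riordanMul-coefficient : ∀ g G F q Q →
      (riordanMulG g f G F ⊛ powS (riordanMulF g f G F) q) Q ≈ sumUpTo (λ t → (g ⊛ powS f t) Q * (G ⊛ powS F q) t) Q
    riordanMul-coefficient g G F q Q = begin
      ((g ⊛ compose G f) ⊛ powS (compose F f) q) Q
        ≈⟨ ⊛-assoc g (compose G f) (powS (compose F f) q) Q ⟩
      (g ⊛ (compose G f ⊛ powS (compose F f) q)) Q
        ≈⟨ ⊛-cong ≋-refl (≋-sym (≋-trans (compose-⊛ G (powS F q)) (⊛-cong ≋-refl (compose-powS F q)))) Q ⟩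
      (g ⊛ compose (G ⊛ powS F q) f) Q
        ≈⟨ ⊛-compose g (G ⊛ powS F q) Q ⟩
      sumUpTo (λ t → (g ⊛ powS f t) Q * (G ⊛ powS F q) t) Q
        ∎

    compose-orderAtLeast : ∀ {F} → OrderAtLeast 1 F → OrderAtLeast 1 (compose F f)
    compose-orderAtLeast ord-F = orderAtLeast-1 (trans (*-cong (ord-F 0 (s≤s z≤n)) refl) (zeroˡ _))

  module KRiordan (k′ : ℕ) where

    open ResidueArithmetic k′

    stretch-divisible : ∀ a n → n % k ≡ 0 → stretch k′ a n ≡ a (n / k)
    stretch-divisible a n n%k≡0 with n % k
    ... | zero = ≡.refl

    stretch-nondivisible : ∀ a n → n % k ≢ 0 → stretch k′ a n ≡ 0#
    stretch-nondivisible a n n%k≢0 with n % k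
    ... | zero  = ⊥-elim (n%k≢0 ≡.refl)
    ... | suc _ = ≡.refl

    stretch-multiple : ∀ a t → stretch k′ a (t ℕ.* k) ≈ a t
    stretch-multiple a t = reflexive (≡.trans (stretch-divisible a (t ℕ.* k) (m*n%n≡0 t k)) (≡.cong a (m*n/n≡m t k)))

    stretch-orderAtLeast : ∀ {p b} → OrderAtLeast p b → OrderAtLeast (p ℕ.* k) (stretch k′ b)
    stretch-orderAtLeast {p} {b} ord-b i i<pk with i % k ℕₚ.≟ 0
    ... | yes i%k≡0 = trans (reflexive (stretch-divisible b i i%k≡0)) (ord-b (i / k) (m<n*o⇒m/o<n i<pk))
    ... | no  i%k≢0 = reflexive (stretch-nondivisible b i i%k≢0)

    sumUpTo-blocks : ∀ Q (h : ℕ → Carrier) →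
      sumUpTo h (Q ℕ.* k ℕ.+ k′) ≈ sumUpTo (λ t → sumUpTo (λ s → h (t ℕ.* k ℕ.+ s)) k′) Q
    sumUpTo-blocks zero    h = refl
    sumUpTo-blocks (suc Q) h = begin
      sumUpTo h (suc Q ℕ.* k ℕ.+ k′)
        ≡⟨ ≡.cong (sumUpTo h) (nextBlockEnd Q k′) ⟩
      sumUpTo h (suc (Q ℕ.* k ℕ.+ k′) ℕ.+ k′)
        ≈⟨ sumUpTo-split (Q ℕ.* k ℕ.+ k′) k′ h ⟩
      sumUpTo h (Q ℕ.* k ℕ.+ k′) + sumUpTo (λ s → h (suc (Q ℕ.* k ℕ.+ k′) ℕ.+ s)) k′
        ≈⟨ +-cong (sumUpTo-blocks Q h) (sumUpTo-cong′ k′ (λ s → reindex h (nextBlockStart Q k′ s))) ⟩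
      sumUpTo (λ t → sumUpTo (λ s → h (t ℕ.* k ℕ.+ s)) k′) (suc Q)
        ∎
      where
      nextBlockEnd : ∀ Q k′ → suc Q ℕ.* suc k′ ℕ.+ k′ ≡ suc (Q ℕ.* suc k′ ℕ.+ k′) ℕ.+ k′
      nextBlockEnd = solve-∀
      nextBlockStart : ∀ Q k′ s → suc (Q ℕ.* suc k′ ℕ.+ k′) ℕ.+ s ≡ suc Q ℕ.* suc k′ ℕ.+ s
      nextBlockStart = solve-∀

    sumUpTo-residue : ∀ Q {r} → r < k → (h : ℕ → Carrier) → (∀ i → i % k ≢ r → h i ≈ 0#) →
      sumUpTo h (Q ℕ.* k ℕ.+ r) ≈ sumUpTo (λ t → h (t ℕ.* k ℕ.+ r)) Q
    sumUpTo-residue Q {r} r<k h h≈0 = begin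
      sumUpTo h (Q ℕ.* k ℕ.+ r)
        ≈⟨ sumUpTo-extend (ℕₚ.+-monoʳ-≤ (Q ℕ.* k) r≤k′) h (λ i r<i i≤k′ → h≈0 i (lastBlockTail i r<i i≤k′)) ⟩
      sumUpTo h (Q ℕ.* k ℕ.+ k′)
        ≈⟨ sumUpTo-blocks Q h ⟩
      sumUpTo (λ t → sumUpTo (λ s → h (t ℕ.* k ℕ.+ s)) k′) Q
        ≈⟨ sumUpTo-cong′ Q (λ t → sumUpTo-single k′ _ r≤k′ (λ s s≤k′ s≢r → h≈0 _ (s≢r ∘ residue t s≤k′))) ⟩
      sumUpTo (λ t → h (t ℕ.* k ℕ.+ r)) Q
        ∎
      where
      r≤k′ : r ≤ k′
      r≤k′ = ℕₚ.≤-pred r<k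
      residue : ∀ t {s} → s ≤ k′ → (t ℕ.* k ℕ.+ s) % k ≡ r → s ≡ r
      residue t s≤k′ eq = ≡.trans (≡.sym ([qk+r]%k≡r t _ (s≤s s≤k′))) eq
      lastBlockTail : ∀ i → Q ℕ.* k ℕ.+ r < i → i ≤ Q ℕ.* k ℕ.+ k′ → i % k ≢ r
      lastBlockTail i r<i i≤k′ i%k≡r = ℕₚ.<⇒≢ r<s (≡.sym (residue Q s≤k′ (≡.subst (λ x → x % k ≡ r) i≡ i%k≡r)))
        where
        s = i ∸ Q ℕ.* k
        i≡ : i ≡ Q ℕ.* k ℕ.+ s
        i≡ = ≡.sym (ℕₚ.m+[n∸m]≡n (ℕₚ.≤-trans (ℕₚ.m≤m+n (Q ℕ.* k) r) (ℕₚ.<⇒≤ r<i)))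
        r<s : r < s
        r<s = ℕₚ.+-cancelˡ-< (Q ℕ.* k) r s (≡.subst (Q ℕ.* k ℕ.+ r <_) i≡ r<i)
        s≤k′ : s ≤ k′
        s≤k′ = ℕₚ.+-cancelˡ-≤ (Q ℕ.* k) s k′ (≡.subst (_≤ Q ℕ.* k ℕ.+ k′) i≡ i≤k′)

    stretch-⊛ : ∀ a b → stretch k′ (a ⊛ b) ≋ (stretch k′ a ⊛ stretch k′ b)
    stretch-⊛ a b N with N % k ℕₚ.≟ 0
    ... | yes N%k≡0 = begin
      stretch k′ (a ⊛ b) N
        ≡⟨ stretch-divisible (a ⊛ b) N N%k≡0 ⟩
      sumUpTo (λ t → a t * b (Q ∸ t)) Q
        ≈⟨ sumUpTo-cong′ Q (λ t → sym (*-cong (stretch-atResidue0 a t) (stretch-b t))) ⟩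
      sumUpTo (λ t → stretch k′ a (t ℕ.* k ℕ.+ 0) * stretch k′ b (Q ℕ.* k ℕ.+ 0 ∸ (t ℕ.* k ℕ.+ 0))) Q
        ≈⟨ sumUpTo-residue Q (s≤s z≤n) _ (λ i i%k≢0 → trans (*-cong (reflexive (stretch-nondivisible a i i%k≢0)) refl) (zeroˡ _)) ⟨
      (stretch k′ a ⊛ stretch k′ b) (Q ℕ.* k ℕ.+ 0)
        ≡⟨ ≡.cong (stretch k′ a ⊛ stretch k′ b) N≡Qk+0 ⟨
      (stretch k′ a ⊛ stretch k′ b) N
        ∎
      where
      Q = N / k
      N≡Qk+0 : N ≡ Q ℕ.* k ℕ.+ 0
      N≡Qk+0 = ≡.trans (n≡[n/k]k+n%k N) (≡.cong (Q ℕ.* k ℕ.+_) N%k≡0)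
      stretch-atResidue0 : ∀ c t → stretch k′ c (t ℕ.* k ℕ.+ 0) ≈ c t
      stretch-atResidue0 c t = trans (reindex (stretch k′ c) (ℕₚ.+-identityʳ (t ℕ.* k))) (stretch-multiple c t)
      index : ∀ t → Q ℕ.* k ℕ.+ 0 ∸ (t ℕ.* k ℕ.+ 0) ≡ (Q ∸ t) ℕ.* k
      index t = ≡.trans (≡.cong₂ _∸_ (ℕₚ.+-identityʳ (Q ℕ.* k)) (ℕₚ.+-identityʳ (t ℕ.* k))) (≡.sym (ℕₚ.*-distribʳ-∸ k Q t))
      stretch-b : ∀ t → stretch k′ b (Q ℕ.* k ℕ.+ 0 ∸ (t ℕ.* k ℕ.+ 0)) ≈ b (Q ∸ t)
      stretch-b t = trans (reindex (stretch k′ b) (index t)) (stretch-multiple b (Q ∸ t))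
    ... | no N%k≢0 = trans (reflexive (stretch-nondivisible (a ⊛ b) N N%k≢0)) (sym (sumUpTo-zero N term))
      where
      term : ∀ i → i ≤ N → stretch k′ a i * stretch k′ b (N ∸ i) ≈ 0#
      term i i≤N with i % k ℕₚ.≟ 0 | (N ∸ i) % k ℕₚ.≟ 0
      ... | no i%k≢0 | _ = trans (*-cong (reflexive (stretch-nondivisible a i i%k≢0)) refl) (zeroˡ _)
      ... | yes _ | no [N∸i]%k≢0 = trans (*-cong refl (reflexive (stretch-nondivisible b (N ∸ i) [N∸i]%k≢0))) (zeroʳ _)
      ... | yes i%k≡0 | yes [N∸i]%k≡0 = ⊥-elim (N%k≢0 (≡.trans (≡.cong (_% k) (≡.sym (ℕₚ.m+[n∸m]≡n i≤N)))
        (≡.trans (%-distribˡ-+ i (N ∸ i) k) (≡.cong₂ (λ u v → (u ℕ.+ v) % k) i%k≡0 [N∸i]%k≡0))))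

    hatColumn : Series → (Fin k → Series) → ℕ → Series
    hatColumn gt fh zero    = gt
    hatColumn gt fh (suc n) = hatColumn gt fh n ⊛ fh (cyc k′ n)

    module _ {gt : Series} {fh : Fin k → Series} (ord-fh : ∀ i → OrderAtLeast 1 (fh i)) where

      hatColumn-orderAtLeast : ∀ n → OrderAtLeast n (hatColumn gt fh n)
      hatColumn-orderAtLeast zero    i ()
      hatColumn-orderAtLeast (suc n) =
        OrderAtLeast-weaken (ℕₚ.≤-reflexive (ℕₚ.+-comm 1 n))
          (⊛-orderAtLeast (hatColumn-orderAtLeast n) (ord-fh (cyc k′ n)))

      kColumn-hatColumn : ∀ n → kColumn k′ gt fh n ≋ shiftDown (n ℕ.* k′) (stretch k′ (hatColumn gt fh n))
      kColumn-hatColumn zero    N = reindex (stretch k′ gt) (≡.sym (ℕₚ.+-identityʳ N))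
      kColumn-hatColumn (suc n) N = begin
        (kColumn k′ gt fh n ⊛ shiftDown k′ (stretch k′ m)) N
          ≈⟨ ⊛-cong (kColumn-hatColumn n) (≋-refl {shiftDown k′ (stretch k′ m)}) N ⟩
        (shiftDown (n ℕ.* k′) (stretch k′ (hatColumn gt fh n)) ⊛ shiftDown k′ (stretch k′ m)) N
          ≈⟨ shiftDown-⊛ ord-column ord-m N ⟩
        (stretch k′ (hatColumn gt fh n) ⊛ stretch k′ m) (N ℕ.+ (n ℕ.* k′ ℕ.+ k′))
          ≈⟨ stretch-⊛ (hatColumn gt fh n) m (N ℕ.+ (n ℕ.* k′ ℕ.+ k′)) ⟨
        stretch k′ (hatColumn gt fh (suc n)) (N ℕ.+ (n ℕ.* k′ ℕ.+ k′))
          ≡⟨ ≡.cong (λ s → stretch k′ (hatColumn gt fh (suc n)) (N ℕ.+ s)) (ℕₚ.+-comm (n ℕ.* k′) k′) ⟩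
        stretch k′ (hatColumn gt fh (suc n)) (N ℕ.+ suc n ℕ.* k′)
          ∎
        where
        m = fh (cyc k′ n)
        ord-column : OrderAtLeast (n ℕ.* k′) (stretch k′ (hatColumn gt fh n))
        ord-column = OrderAtLeast-weaken (ℕₚ.*-monoʳ-≤ n (ℕₚ.n≤1+n k′)) (stretch-orderAtLeast (hatColumn-orderAtLeast n))
        ord-m : OrderAtLeast k′ (stretch k′ m)
        ord-m = OrderAtLeast-weaken k′≤1*k (stretch-orderAtLeast (ord-fh (cyc k′ n)))
          where
          k′≤1*k : k′ ≤ 1 ℕ.* k
          k′≤1*k = ℕₚ.≤-trans (ℕₚ.n≤1+n k′) (ℕₚ.≤-reflexive (≡.sym (ℕₚ.+-identityʳ k)))

    toℕ-cyc : ∀ {r} → r < k → toℕ (cyc k′ r) ≡ r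
    toℕ-cyc {r} r<k = ≡.trans (Finₚ.toℕ-fromℕ< (m%n<n r k)) (m<n⇒m%n≡m r<k)

    cyc-+k : ∀ n → cyc k′ (n ℕ.+ k) ≡ cyc k′ n
    cyc-+k n = Finₚ.fromℕ<-cong _ _ ([m+n]%n≡m%n n k) (m%n<n (n ℕ.+ k) k) (m%n<n n k)

    module Hits (j : Fin k) where

      hits : ℕ → ℕ
      hits zero = 0
      hits (suc n) with cyc k′ n ≟ j
      ... | yes _ = suc (hits n)
      ... | no  _ = hits n

      misses : ℕ → ℕ
      misses zero = 0
      misses (suc n) with cyc k′ n ≟ j
      ... | yes _ = misses n
      ... | no  _ = suc (misses n)

      hits+misses : ∀ n → hits n ℕ.+ misses n ≡ n
      hits+misses zero = ≡.refl
      hits+misses (suc n) with cyc k′ n ≟ j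
      ... | yes _ = ≡.cong suc (hits+misses n)
      ... | no  _ = ≡.trans (ℕₚ.+-suc (hits n) (misses n)) (≡.cong suc (hits+misses n))

      hits-beforeJ : ∀ r → r ≤ toℕ j → hits r ≡ 0
      hits-beforeJ zero    _     = ≡.refl
      hits-beforeJ (suc r) 1+r≤j with cyc k′ r ≟ j
      ... | yes cyc≡j = ⊥-elim (ℕₚ.<⇒≢ 1+r≤j (≡.trans (≡.sym (toℕ-cyc r<k)) (≡.cong toℕ cyc≡j)))
        where
        r<k : r < k
        r<k = ℕₚ.<-≤-trans 1+r≤j (ℕₚ.<⇒≤ (Finₚ.toℕ<n j))
      ... | no  _ = hits-beforeJ r (ℕₚ.<⇒≤ 1+r≤j)

      hits-afterJ : ∀ d → d ℕ.+ toℕ j < k → hits (suc (d ℕ.+ toℕ j)) ≡ 1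
      hits-afterJ d d+j<k with cyc k′ (d ℕ.+ toℕ j) ≟ j
      hits-afterJ zero    d+j<k | yes _     = ≡.cong suc (hits-beforeJ (toℕ j) ℕₚ.≤-refl)
      hits-afterJ (suc d) d+j<k | yes cyc≡j =
        ⊥-elim (ℕₚ.<⇒≢ (s≤s (ℕₚ.m≤n+m (toℕ j) d)) (≡.sym (≡.trans (≡.sym (toℕ-cyc d+j<k)) (≡.cong toℕ cyc≡j))))
      hits-afterJ zero    d+j<k | no cyc≢j  = ⊥-elim (cyc≢j (Finₚ.toℕ-injective (toℕ-cyc d+j<k)))
      hits-afterJ (suc d) d+j<k | no  _     = hits-afterJ d (ℕₚ.<-trans (ℕₚ.n<1+n _) d+j<k)

      hits-period : hits k ≡ 1
      hits-period = ≡.subst (λ n → hits (suc n) ≡ 1) [k′∸j]+j≡k′ (hits-afterJ (k′ ∸ toℕ j) (s≤s (ℕₚ.≤-reflexive [k′∸j]+j≡k′)))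
        where
        [k′∸j]+j≡k′ : k′ ∸ toℕ j ℕ.+ toℕ j ≡ k′
        [k′∸j]+j≡k′ = ℕₚ.m∸n+n≡m (ℕₚ.≤-pred (Finₚ.toℕ<n j))

      hits-+k : ∀ n → hits (n ℕ.+ k) ≡ suc (hits n)
      hits-+k zero = hits-period
      hits-+k (suc n) with cyc k′ (n ℕ.+ k) ≟ j | cyc k′ n ≟ j
      ... | yes _          | yes _          = ≡.cong suc (hits-+k n)
      ... | no  _          | no  _          = hits-+k n
      ... | yes cycn+k≡j   | no  cycn≢j     = ⊥-elim (cycn≢j (≡.trans (≡.sym (cyc-+k n)) cycn+k≡j))
      ... | no  cycn+k≢j   | yes cycn≡j     = ⊥-elim (cycn+k≢j (≡.trans (cyc-+k n) cycn≡j))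

      hits-multiple : ∀ t r → hits (t ℕ.* k ℕ.+ r) ≡ t ℕ.+ hits r
      hits-multiple zero    r = ≡.refl
      hits-multiple (suc t) r = ≡.trans (≡.cong hits (nextPeriod t k′ r))
                                        (≡.trans (hits-+k (t ℕ.* k ℕ.+ r)) (≡.cong suc (hits-multiple t r)))
        where
        nextPeriod : ∀ t k′ r → suc t ℕ.* suc k′ ℕ.+ r ≡ t ℕ.* suc k′ ℕ.+ r ℕ.+ suc k′
        nextPeriod = solve-∀

      hits+misses-multiple : ∀ t r → hits r ℕ.+ misses (t ℕ.* k ℕ.+ r) ≡ t ℕ.* k′ ℕ.+ r
      hits+misses-multiple t r = ℕₚ.+-cancelˡ-≡ t _ _
        (≡.trans (≡.sym (ℕₚ.+-assoc t (hits r) (misses n)))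
        (≡.trans (≡.cong (ℕ._+ misses n) (≡.sym (hits-multiple t r)))
        (≡.trans (hits+misses n) (unfoldPeriod t k′ r))))
        where
        n = t ℕ.* k ℕ.+ r
        unfoldPeriod : ∀ t k′ r → t ℕ.* suc k′ ℕ.+ r ≡ t ℕ.+ (t ℕ.* k′ ℕ.+ r)
        unfoldPeriod = solve-∀

    module Embedding (j : Fin k) where

      open Hits j

      multsAt-orderAtLeast : ∀ {f} → OrderAtLeast 1 f → ∀ i → OrderAtLeast 1 (multsAt k′ j f i)
      multsAt-orderAtLeast ord-f i with i ≟ j
      ... | yes _ = ord-f
      ... | no  _ = zS-orderAtLeast

      hatColumn-multsAt : ∀ g f n → hatColumn g (multsAt k′ j f) n ≋ (powS zS (misses n) ⊛ (g ⊛ powS f (hits n)))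
      hatColumn-multsAt g f zero = ≋-sym (≋-trans (⊛-identityˡ _) (⊛-identityʳ g))
      hatColumn-multsAt g f (suc n) with cyc k′ n ≟ j
      ... | yes _ = ≋-trans (⊛-cong (hatColumn-multsAt g f n) (≋-refl {f}))
                    (≋-trans (⊛-assoc Z (g ⊛ P) f)
                    (⊛-cong (≋-refl {Z}) (≋-trans (⊛-assoc g P f) (⊛-cong (≋-refl {g}) (⊛-comm P f)))))
        where
        Z = powS zS (misses n)
        P = powS f (hits n)
      ... | no  _ = ≋-trans (⊛-cong (hatColumn-multsAt g f n) (≋-refl {zS}))
                    (≋-trans (⊛-assoc Z (g ⊛ P) zS) (≋-trans (⊛-cong (≋-refl {Z}) (⊛-comm (g ⊛ P) zS))
                    (≋-trans (≋-sym (⊛-assoc Z zS (g ⊛ P))) (⊛-cong (⊛-comm Z zS) (≋-refl {g ⊛ P})))))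
        where
        Z = powS zS (misses n)
        P = powS f (hits n)

      module _ {g f : Series} (ord-f : OrderAtLeast 1 f) where

        phiAt-hatColumn : ∀ N n → phiAt k′ j g f N n ≈ stretch k′ (hatColumn g (multsAt k′ j f) n) (N ℕ.+ n ℕ.* k′)
        phiAt-hatColumn N n = kColumn-hatColumn (multsAt-orderAtLeast ord-f) n N

        phiAt-offResidue : ∀ N n → N % k ≢ n % k → phiAt k′ j g f N n ≈ 0#
        phiAt-offResidue N n N≢n = trans (phiAt-hatColumn N n)
          (reflexive (stretch-nondivisible _ (N ℕ.+ n ℕ.* k′) (N≢n ∘ [N+nk′]%k≡0⇒N%k≡n%k N n)))

        phiAt-onResidue : ∀ Q t r → phiAt k′ j g f (Q ℕ.* k ℕ.+ r) (t ℕ.* k ℕ.+ r) ≈ (g ⊛ powS f (hits r ℕ.+ t)) (hits r ℕ.+ Q)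
        phiAt-onResidue Q t r = begin
          phiAt k′ j g f (Q ℕ.* k ℕ.+ r) n
            ≈⟨ phiAt-hatColumn (Q ℕ.* k ℕ.+ r) n ⟩
          stretch k′ (hatColumn g (multsAt k′ j f) n) (Q ℕ.* k ℕ.+ r ℕ.+ n ℕ.* k′)
            ≡⟨ ≡.cong (stretch k′ _) (rowIndex Q k′ r t) ⟩
          stretch k′ (hatColumn g (multsAt k′ j f) n) ((Q ℕ.+ t ℕ.* k′ ℕ.+ r) ℕ.* k)
            ≈⟨ stretch-multiple _ (Q ℕ.+ t ℕ.* k′ ℕ.+ r) ⟩
          hatColumn g (multsAt k′ j f) n (Q ℕ.+ t ℕ.* k′ ℕ.+ r)
            ≈⟨ hatColumn-multsAt g f n _ ⟩
          (powS zS (misses n) ⊛ (g ⊛ powS f (hits n))) (Q ℕ.+ t ℕ.* k′ ℕ.+ r)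
            ≡⟨ ≡.cong₂ (λ e i → (powS zS (misses n) ⊛ (g ⊛ powS f e)) i) hits≡ index ⟩
          (powS zS (misses n) ⊛ (g ⊛ powS f (hits r ℕ.+ t))) (misses n ℕ.+ (hits r ℕ.+ Q))
            ≈⟨ powS-zS-⊛ (misses n) (g ⊛ powS f (hits r ℕ.+ t)) (hits r ℕ.+ Q) ⟩
          (g ⊛ powS f (hits r ℕ.+ t)) (hits r ℕ.+ Q)
            ∎
          where
          n = t ℕ.* k ℕ.+ r
          rowIndex : ∀ Q k′ r t →
            Q ℕ.* suc k′ ℕ.+ r ℕ.+ (t ℕ.* suc k′ ℕ.+ r) ℕ.* k′ ≡ (Q ℕ.+ t ℕ.* k′ ℕ.+ r) ℕ.* suc k′
          rowIndex = solve-∀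
          shuffle : ∀ Q a b → Q ℕ.+ (a ℕ.+ b) ≡ b ℕ.+ (a ℕ.+ Q)
          shuffle = solve-∀
          hits≡ : hits n ≡ hits r ℕ.+ t
          hits≡ = ≡.trans (hits-multiple t r) (ℕₚ.+-comm t (hits r))
          index : Q ℕ.+ t ℕ.* k′ ℕ.+ r ≡ misses n ℕ.+ (hits r ℕ.+ Q)
          index = ≡.trans (ℕₚ.+-assoc Q (t ℕ.* k′) r)
                  (≡.trans (≡.cong (Q ℕ.+_) (≡.sym (hits+misses-multiple t r))) (shuffle Q (hits r) (misses n)))

      module _ {g f G F : Series} (ord-f : OrderAtLeast 1 f) (ord-F : OrderAtLeast 1 F) where

        φ₁ φ₂ φ₁₂ : Matrix
        φ₁  = phiAt k′ j g f
        φ₂  = phiAt k′ j G F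
        φ₁₂ = phiAt k′ j (riordanMulG g f G F) (riordanMulF g f G F)

        phiAt-mul-onResidue : ∀ Q q {r} → r < k →
          φ₁₂ (Q ℕ.* k ℕ.+ r) (q ℕ.* k ℕ.+ r) ≈ (φ₁ ·ₘ φ₂) (Q ℕ.* k ℕ.+ r) (q ℕ.* k ℕ.+ r)
        phiAt-mul-onResidue Q q {r} r<k = begin
          φ₁₂ (Q ℕ.* k ℕ.+ r) (q ℕ.* k ℕ.+ r)
            ≈⟨ phiAt-onResidue {g = riordanMulG g f G F} (compose-orderAtLeast ord-f ord-F) Q q r ⟩
          (riordanMulG g f G F ⊛ powS (riordanMulF g f G F) (e ℕ.+ q)) (e ℕ.+ Q)
            ≈⟨ riordanMul-coefficient ord-f g G F (e ℕ.+ q) (e ℕ.+ Q) ⟩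
          sumUpTo (λ t → (g ⊛ powS f t) (e ℕ.+ Q) * (G ⊛ powS F (e ℕ.+ q)) t) (e ℕ.+ Q)
            ≈⟨ sumUpTo-dropZeros e Q _ firstTermsVanish ⟩
          sumUpTo (λ t → (g ⊛ powS f (e ℕ.+ t)) (e ℕ.+ Q) * (G ⊛ powS F (e ℕ.+ q)) (e ℕ.+ t)) Q
            ≈⟨ sumUpTo-cong′ Q (λ t → *-cong (phiAt-onResidue ord-f Q t r) (phiAt-onResidue ord-F t q r)) ⟨
          sumUpTo (λ t → φ₁ (Q ℕ.* k ℕ.+ r) (t ℕ.* k ℕ.+ r) * φ₂ (t ℕ.* k ℕ.+ r) (q ℕ.* k ℕ.+ r)) Q
            ≈⟨ sumUpTo-residue Q r<k _ offResidueTermsVanish ⟨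
          (φ₁ ·ₘ φ₂) (Q ℕ.* k ℕ.+ r) (q ℕ.* k ℕ.+ r)
            ∎
          where
          e = hits r
          firstTermsVanish : ∀ t → t < e → (g ⊛ powS f t) (e ℕ.+ Q) * (G ⊛ powS F (e ℕ.+ q)) t ≈ 0#
          firstTermsVanish t t<e = trans (*-cong refl (ord-GFᵉ⁺q t (ℕₚ.<-≤-trans t<e (ℕₚ.m≤m+n e q)))) (zeroʳ _)
            where
            ord-GFᵉ⁺q : OrderAtLeast (e ℕ.+ q) (G ⊛ powS F (e ℕ.+ q))
            ord-GFᵉ⁺q = ⊛-orderAtLeast {s = 0} (λ _ ()) (powS-orderAtLeast ord-F (e ℕ.+ q))
          offResidueTermsVanish : ∀ i → i % k ≢ r → φ₁ (Q ℕ.* k ℕ.+ r) i * φ₂ i (q ℕ.* k ℕ.+ r) ≈ 0#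
          offResidueTermsVanish i i%k≢r = trans (*-cong (phiAt-offResidue ord-f _ i row≢i) refl) (zeroˡ _)
            where
            row≢i : (Q ℕ.* k ℕ.+ r) % k ≢ i % k
            row≢i eq = i%k≢r (≡.trans (≡.sym eq) ([qk+r]%k≡r Q r r<k))

        phiAt-mul : φ₁₂ ≐ (φ₁ ·ₘ φ₂)
        phiAt-mul N n with N % k ℕₚ.≟ n % k
        ... | yes N≡n = begin
          φ₁₂ N n                                        ≡⟨ ≡.cong₂ φ₁₂ N≡ n≡ ⟩
          φ₁₂ (N / k ℕ.* k ℕ.+ N % k) (n / k ℕ.* k ℕ.+ N % k)
            ≈⟨ phiAt-mul-onResidue (N / k) (n / k) (m%n<n N k) ⟩
          (φ₁ ·ₘ φ₂) (N / k ℕ.* k ℕ.+ N % k) (n / k ℕ.* k ℕ.+ N % k) ≡⟨ ≡.cong₂ (φ₁ ·ₘ φ₂) N≡ n≡ ⟨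
          (φ₁ ·ₘ φ₂) N n                                 ∎
          where
          N≡ : N ≡ N / k ℕ.* k ℕ.+ N % k
          N≡ = n≡[n/k]k+n%k N
          n≡ : n ≡ n / k ℕ.* k ℕ.+ N % k
          n≡ = ≡.trans (n≡[n/k]k+n%k n) (≡.cong (n / k ℕ.* k ℕ.+_) (≡.sym N≡n))
        ... | no N≢n = trans (phiAt-offResidue (compose-orderAtLeast ord-f ord-F) N n N≢n) (sym (sumUpTo-zero N term))
          where
          term : ∀ i → i ≤ N → φ₁ N i * φ₂ i n ≈ 0#
          term i _ with N % k ℕₚ.≟ i % k
          ... | no  N≢i = trans (*-cong (phiAt-offResidue ord-f N i N≢i) refl) (zeroˡ _)
          ... | yes N≡i = trans (*-cong refl (phiAt-offResidue ord-F i n (N≢n ∘ ≡.trans N≡i))) (zeroʳ _)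

module FieldSeries {c ℓ : Level} (K : Field c ℓ) where

  open Field K using (inverse)
  open CommutativeRing (Field.ring K)
  open FPS (Field.ring K)
  open SeriesProperties (Field.ring K)
  open SetoidReasoning setoid
  open GroupProperties +-group using (∙-cancelˡ)

  *-cancelʳ-nonzero : ∀ {x} → ¬ (x ≈ 0#) → ∀ {u v} → u * x ≈ v * x → u ≈ v
  *-cancelʳ-nonzero {x} x≉0 {u} {v} ux≈vx = begin
    u              ≈⟨ *-identityʳ u ⟨
    u * 1#         ≈⟨ *-cong refl xy≈1 ⟨
    u * (x * y)    ≈⟨ *-assoc u x y ⟨
    u * x * y      ≈⟨ *-cong ux≈vx refl ⟩
    v * x * y      ≈⟨ *-assoc v x y ⟩
    v * (x * y)    ≈⟨ *-cong refl xy≈1 ⟩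
    v * 1#         ≈⟨ *-identityʳ v ⟩
    v              ∎
    where
    y = proj₁ (inverse x x≉0)
    xy≈1 = proj₂ (inverse x x≉0)

  ⊛-cancelʳ : ∀ {g} → InF0 g → ∀ {a b} → (a ⊛ g) ≋ (b ⊛ g) → a ≋ b
  ⊛-cancelʳ {g} g0≉0 {a} {b} ag≋bg n = agreeUpTo n n ℕₚ.≤-refl
    where
    agreeUpTo : ∀ n i → i ≤ n → a i ≈ b i
    agreeUpTo zero    _     z≤n    = *-cancelʳ-nonzero g0≉0 (ag≋bg 0)
    agreeUpTo (suc n) i     i≤1+n with ℕₚ.m≤n⇒m<n∨m≡n i≤1+n
    ... | inj₁ i<1+n  = agreeUpTo n i (ℕₚ.≤-pred i<1+n)
    ... | inj₂ ≡.refl = *-cancelʳ-nonzero g0≉0 (≡.subst (λ m → a (suc n) * g m ≈ b (suc n) * g m) (ℕₚ.n∸n≡0 n) lastTerms)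
      where
      lastTerms : a (suc n) * g (n ∸ n) ≈ b (suc n) * g (n ∸ n)
      lastTerms = ∙-cancelˡ _ _ _ (trans (ag≋bg (suc n))
        (+-cong (sumUpTo-cong n (λ i i≤n → *-cong (sym (agreeUpTo n i i≤n)) refl)) refl))

  phiAt-injective : ∀ k′ j {g f G F} → InF0 g → OrderAtLeast 1 f → OrderAtLeast 1 F →
    phiAt k′ j g f ≐ phiAt k′ j G F → (g ≋ G) × (f ≋ F)
  phiAt-injective k′ j {g} {f} {G} {F} g0≉0 ord-f ord-F φ≐Φ = g≋G , f≋F
    where
    open KRiordan k′
    open Embedding j
    columns : ∀ t → (g ⊛ powS f t) ≋ (G ⊛ powS F t)
    columns t Q = trans (sym (phiAt-onResidue {g = g} ord-f Q t 0))
                        (trans (φ≐Φ (Q ℕ.* suc k′ ℕ.+ 0) (t ℕ.* suc k′ ℕ.+ 0)) (phiAt-onResidue {g = G} ord-F Q t 0))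
    g≋G : g ≋ G
    g≋G = ≋-trans (≋-sym (⊛-identityʳ g)) (≋-trans (columns 0) (⊛-identityʳ G))
    fg≋Fg : (f ⊛ g) ≋ (F ⊛ g)
    fg≋Fg = ≋-trans (⊛-comm f g) (≋-trans (⊛-cong (≋-refl {g}) (≋-sym (⊛-identityʳ f)))
            (≋-trans (columns 1) (≋-trans (⊛-cong (≋-sym g≋G) (⊛-identityʳ F)) (⊛-comm g F))))
    f≋F : f ≋ F
    f≋F = ⊛-cancelʳ {g} g0≉0 fg≋Fg

  phiAt-isMono : ∀ k′ j → IsMonoAt k′ j
  phiAt-isMono k′ j = multiplicative , injective
    where
    open KRiordan k′
    open Embedding j
    multiplicative : ∀ g f G F → InF0 g → InF1 f → InF0 G → InF1 F →
      phiAt k′ j (riordanMulG g f G F) (riordanMulF g f G F) ≐ (phiAt k′ j g f ·ₘ phiAt k′ j G F)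
    multiplicative g f G F _ (f0≈0 , _) _ (F0≈0 , _) = phiAt-mul (orderAtLeast-1 f0≈0) (orderAtLeast-1 F0≈0)
    injective : ∀ g f G F → InF0 g → InF1 f → InF0 G → InF1 F →
      phiAt k′ j g f ≐ phiAt k′ j G F → (g ≋ G) × (f ≋ F)
    injective g f G F g∈F0 (f0≈0 , _) _ (F0≈0 , _) =
      phiAt-injective k′ j g∈F0 (orderAtLeast-1 f0≈0) (orderAtLeast-1 F0≈0)

corollary2p1 : ∀ {c ℓ} (K : Field c ℓ) → (k' : ℕ) →
    FPS.IsMonoAt (Field.ring K) k' (fromℕ k')
      × ((j : Fin (suc k')) → FPS.IsMonoAt (Field.ring K) k' j)
corollary2p1 K k' = phiAt-isMono k' (fromℕ k') , phiAt-isMono k'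
  where open FieldSeries K
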